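{- Let $H$ be a fixed graph with $H \neq P_2 + sP_1$ for $s \in \{0,1,2\}$ and $H \neq sP_1$ for $s \in \{1,2,3\}$. Then any streaming algorithm for \textsc{Diameter} in the AL model that uses $p$ passes over the stream must use $\Omega(n/p)$ bits of memory on $n$-vertex graphs $G$, even when the algorithm is given a set $X \subseteq V(G)$ of constant size such that $G - X$ is $H$-free. If moreover $H \neq P_3$, the same lower bound holds even when it is additionally required that $G - X$ is connected (and $H$-free).
   Context: Graphs are finite, simple, undirected, unweighted. $P_a$ is the path on $a$ vertices; $G_1+G_2$ is the disjoint union, and $sG$ is the disjoint union of $s$ copies of $G$. $G$ is $H$-free if it has no induced subgraph isomorphic to $H$; $G-X$ is the graph obtained by deleting the vertices of $X$. \textsc{Diameter}: compute $\max_{s,t} d(s,t)$ (shortest-path distance). In the Adjacency List (AL) streaming model the graph arrives as a sequence of vertices in arbitrary fixed order, each together with the full list of its incident edges (each edge appears twice). A $p$-pass algorithm reads the sequence $p$ times with unlimited computation; memory is measured in bits. "Must use $\Omega(f)$ bits" means there is a constant $c>0$ such that every $p$-pass algorithm solving the problem correctly on all inputs of the stated class uses at least $c\cdot f$ bits on some $n$-vertex input, for all sufficiently large $n$ and all $p$. -}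

module Defs where

open import Data.Nat using (ℕ; zero; suc; _+_; _*_; _≤_; _<_)
open import Data.Bool using (Bool; true; false)
open import Data.Fin using (Fin; zero; suc)
open import Data.Fin.Subset using (Subset; _∈_; _∉_; ∣_∣)
open import Data.List using (List; []; _∷_; map; concatMap; foldl; allFin)
open import Data.List.Membership.Propositional using () renaming (_∈_ to _∈ₗ_)
open import Data.List.Relation.Unary.Unique.Propositional using (Unique)
open import Data.List.Relation.Binary.Permutation.Propositional using (_↭_)
open import Data.Vec using (Vec)
open import Data.Maybe using (Maybe; just; nothing)
open import Data.Product using (Σ; _×_; _,_; ∃; ∃-syntax)
open import Relation.Binary.PropositionalEquality using (_≡_)
open import Relation.Nullary using (¬_)
open import Function.Bundles using (_⇔_)

record Graph (n : ℕ) : Set where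
  field
    adj   : Fin n → Fin n → Bool
    sym   : ∀ u v → adj u v ≡ adj v u
    irrefl : ∀ v → adj v v ≡ false
open Graph public

record Iso {m n : ℕ} (G : Graph m) (H : Graph n) : Set where
  field
    to      : Fin m → Fin n
    from    : Fin n → Fin m
    from∘to : ∀ x → from (to x) ≡ x
    to∘from : ∀ y → to (from y) ≡ y
    pres    : ∀ u v → adj H (to u) (to v) ≡ adj G u v

edgeless : (s : ℕ) → Graph s
edgeless s = record { adj = λ _ _ → false ; sym = λ _ _ → _≡_.refl ; irrefl = λ _ → _≡_.refl }

p2adj : ∀ {s} → Fin (2 + s) → Fin (2 + s) → Bool
p2adj zero (suc zero) = true
p2adj (suc zero) zero = true
p2adj _ _ = false

p2sym : ∀ {s} (u v : Fin (2 + s)) → p2adj u v ≡ p2adj v u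
p2sym zero zero = _≡_.refl
p2sym zero (suc zero) = _≡_.refl
p2sym zero (suc (suc v)) = _≡_.refl
p2sym (suc zero) zero = _≡_.refl
p2sym (suc zero) (suc zero) = _≡_.refl
p2sym (suc zero) (suc (suc v)) = _≡_.refl
p2sym (suc (suc u)) zero = _≡_.refl
p2sym (suc (suc u)) (suc zero) = _≡_.refl
p2sym (suc (suc u)) (suc (suc v)) = _≡_.refl

p2irr : ∀ {s} (v : Fin (2 + s)) → p2adj v v ≡ false
p2irr zero = _≡_.refl
p2irr (suc zero) = _≡_.refl
p2irr (suc (suc v)) = _≡_.refl

P₂+_P₁ : (s : ℕ) → Graph (2 + s)
P₂+ s P₁ = record { adj = p2adj ; sym = p2sym ; irrefl = p2irr }

p3adj : Fin 3 → Fin 3 → Bool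
p3adj zero (suc zero) = true
p3adj (suc zero) zero = true
p3adj (suc zero) (suc (suc zero)) = true
p3adj (suc (suc zero)) (suc zero) = true
p3adj _ _ = false

p3sym : ∀ u v → p3adj u v ≡ p3adj v u
p3sym zero zero = _≡_.refl
p3sym zero (suc zero) = _≡_.refl
p3sym zero (suc (suc zero)) = _≡_.refl
p3sym (suc zero) zero = _≡_.refl
p3sym (suc zero) (suc zero) = _≡_.refl
p3sym (suc zero) (suc (suc zero)) = _≡_.refl
p3sym (suc (suc zero)) zero = _≡_.refl
p3sym (suc (suc zero)) (suc zero) = _≡_.refl
p3sym (suc (suc zero)) (suc (suc zero)) = _≡_.refl

p3irr : ∀ v → p3adj v v ≡ false
p3irr zero = _≡_.refl
p3irr (suc zero) = _≡_.refl
p3irr (suc (suc zero)) = _≡_.refl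

P₃ : Graph 3
P₃ = record { adj = p3adj ; sym = p3sym ; irrefl = p3irr }

data WalkIn {n} (G : Graph n) (S : Subset n) : Fin n → Fin n → ℕ → Set where
  here : ∀ {s} → s ∈ S → WalkIn G S s s 0
  step : ∀ {s u t k} → s ∈ S → adj G s u ≡ true → WalkIn G S u t k → WalkIn G S s t (suc k)

Walk : ∀ {n} → Graph n → Fin n → Fin n → ℕ → Set
Walk {n} G = WalkIn G (Data.Fin.Subset.⊤)

-- DiameterIs G d : d is the diameter of G, where nothing = ∞
-- (i.e. some pair of vertices is at infinite distance).
DiameterIs : ∀ {n} → Graph n → Maybe ℕ → Set
DiameterIs G (just D) =
  (∀ s t → ∃[ k ] (k ≤ D × Walk G s t k)) ×
  (∃[ s ] ∃[ t ] (∀ k → k < D → ¬ Walk G s t k))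
DiameterIs G nothing = ∃[ s ] ∃[ t ] (∀ k → ¬ Walk G s t k)

verticesMinus : ∀ {n} → Graph n → Subset n → Subset n
verticesMinus G X = Data.Fin.Subset.∁ X

HFreeMinus : ∀ {m n} → Graph m → Graph n → Subset n → Set
HFreeMinus {m} {n} H G X =
  ¬ (Σ (Fin m → Fin n) λ f →
       (∀ i j → f i ≡ f j → i ≡ j) ×
       (∀ i → f i ∉ X) ×
       (∀ i j → adj G (f i) (f j) ≡ adj H i j))

ConnectedMinus : ∀ {n} → Graph n → Subset n → Set
ConnectedMinus G X = ∀ s t → s ∉ X → t ∉ X → ∃[ k ] WalkIn G (verticesMinus G X) s t k

record ALItem (n : ℕ) : Set where
  constructor item
  field
    vertex : Fin n
    nbrs   : List (Fin n)
open ALItem public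

ValidStream : ∀ {n} → Graph n → List (ALItem n) → Set
ValidStream {n} G σ =
  (map vertex σ ↭ allFin n) ×
  (∀ {it} → it ∈ₗ σ → Unique (nbrs it) ×
     (∀ u → (u ∈ₗ nbrs it) ⇔ (adj G (vertex it) u ≡ true)))

data Token (n : ℕ) : Set where
  vtx  : Fin n → Token n
  edge : Fin n → Fin n → Token n

tokens : ∀ {n} → List (ALItem n) → List (Token n)
tokens = concatMap (λ it → vtx (vertex it) ∷ map (edge (vertex it)) (nbrs it))

-- A deterministic p-pass streaming algorithm on n-vertex inputs with b
-- bits of memory (memory state = bit string of length b).  Unlimited
-- computation: transitions are arbitrary functions.  It may depend
-- arbitrarily on the given set X and knows the current pass index.
record Algorithm (n p b : ℕ) : Set where
  field
    init : Vec Bool b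
    trans : ℕ → Token n → Vec Bool b → Vec Bool b
    out  : Vec Bool b → Maybe ℕ
open Algorithm public

runPasses : ∀ {n p b} → Algorithm n p b → List (Token n) → ℕ → ℕ → Vec Bool b → Vec Bool b
runPasses A ts i zero st = st
runPasses A ts i (suc r) st = runPasses A ts (suc i) r (foldl (λ s t → trans A i t s) st ts)

runAlg : ∀ {n p b} → Algorithm n p b → List (ALItem n) → Maybe ℕ
runAlg {p = p} A σ = out A (runPasses A (tokens σ) 0 p (init A))

InputClass : ℕ → Set₁
InputClass n = Graph n → Subset n → Set

SolvesDiameter : ∀ {n p b} → InputClass n → (Subset n → Algorithm n p b) → Set
SolvesDiameter C A = ∀ G X → C G X → ∀ σ → ValidStream G σ → DiameterIs G (runAlg (A X) σ)

-- Ω(n/p) lower bound for a family of classes (one per n): there are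
-- constants q ≥ 1 (c = 1/q) and N such that for all n ≥ N, all p ≥ 1, every
-- correct p-pass algorithm with b bits satisfies n/p ≤ q·b.
LowerBoundΩnp : (∀ n → InputClass n) → Set
LowerBoundΩnp C = ∃[ q ] ∃[ N ] (∀ n → N ≤ n → ∀ p → 1 ≤ p → ∀ b →
  (A : Subset n → Algorithm n p b) → SolvesDiameter (C n) A → n ≤ q * (b * p))

Class₁ : ∀ {m} → Graph m → ℕ → ∀ n → InputClass n
Class₁ H k n G X = (∣ X ∣ ≤ k) × HFreeMinus H G X

Class₂ : ∀ {m} → Graph m → ℕ → ∀ n → InputClass n
Class₂ H k n G X = (∣ X ∣ ≤ k) × HFreeMinus H G X × ConnectedMinus G X

-- Reduction from set disjointness. For x, y ∈ {0,1}ᴺ the graph G(x, y) has vertices a₁…a_N, c, h, r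
-- (held by Alice) and b₁…b_N, z (held by Bob), with aᵢ ∼ c iff xᵢ = 0, bᵢ ∼ z iff yᵢ = 0 and aᵢ ∼ bᵢ.
-- The hub h sees every vertex but z, so the diameter is at most 2 unless some aᵢ is far from z, which
-- happens exactly when xᵢ = yᵢ = 1. Listing Alice's vertices first, a p-pass run is determined by the
-- 2p memory states at the boundary between the two halves of the stream; if 2bp < N, two inputs of the
-- fooling set {(x, ¬x)} share these states, and exchanging their second halves fools the algorithm.
-- Deleting X = {c, h, z} (plus one padding vertex for odd n) leaves a core on {aᵢ, bᵢ, r} whose edges
-- do not depend on x, y; four flags choose it among a perfect matching (P₃-free), a spider (K₃-free),
-- a split graph (2K₂- and C₄-free), two cliques (3P₁-free) and a matching plus a universal vertex
-- (P₄-free), all but the first connected. Every H outside the excluded list has an induced P₃, K₃, 2K₂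
-- or 3P₁, and one of K₃, 2K₂, 3P₁, P₄, C₄ unless H = P₃, so one of these cores is H-free.

module Submission where

open import Defs hiding (sym; trans)
open import Data.Bool using (Bool; true; false; not; _∧_; _∨_)
import Data.Bool.Properties as Bool
open import Data.Empty using (⊥; ⊥-elim)
open import Data.Fin using (Fin; zero; suc; _≟_; splitAt; join; _↑ˡ_; _↑ʳ_; combine; remQuot)
open import Data.Fin.Permutation.Components using (transpose; transpose-inverse)
open import Data.Fin.Properties
  using ( any?; pigeonhole; <⇒≢; remQuot-combine; combine-remQuot
        ; splitAt-join; join-splitAt; splitAt-↑ˡ; splitAt-↑ʳ)
open import Data.Fin.Subset using (Subset; ∣_∣; _∈_; _∉_; ∁) renaming (⊥ to ∅; ⊤ to full)
open import Data.Fin.Subset.Properties using (∈⊤; ∣⊥∣≡0; ∣⊤∣≡n; x∉p⇒x∈∁p)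
open import Data.List using (List; []; _∷_; _++_; foldl; filter; map; allFin; tabulate)
open import Data.List.Membership.Propositional using () renaming (_∈_ to _∈ₗ_)
open import Data.List.Membership.Propositional.Properties
  using (∈-++⁻; ∈-tabulate⁻; ∈-filter⁺; ∈-filter⁻; ∈-allFin)
open import Data.List.Properties using (foldl-++; concatMap-++; map-++; map-tabulate)
open import Data.List.Relation.Binary.Permutation.Propositional using (↭-reflexive)
open import Data.List.Relation.Unary.Unique.Propositional using (Unique)
open import Data.List.Relation.Unary.Unique.Propositional.Properties using (filter⁺; allFin⁺)
open import Data.Maybe using (just; nothing)
open import Data.Nat using (ℕ; zero; suc; _+_; _*_; _^_; _∸_; _≤_; _<_; z≤n; s≤s)
open import Data.Nat.Properties
  using ( ≤-trans; ≤-reflexive; ≮⇒≥; +-comm; +-suc; m+[n∸m]≡n; +-monoˡ-≤; +-monoʳ-≤; *-monoʳ-≤; ^-monoʳ-<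
        ; module ≤-Reasoning)
open import Data.Nat.Tactic.RingSolver using (solve-∀)
open import Data.Product using (Σ; ∃; ∃₂; ∃-syntax; _×_; _,_; proj₁; proj₂)
open import Data.Sum using (_⊎_; inj₁; inj₂; [_,_]′)
import Data.Sum as Sum
open import Data.Vec using (Vec; []; _∷_; lookup) renaming (_++_ to _++ᵛ_; map to mapᵛ)
open import Data.Vec.Properties
  using (++-injective; lookup-++ˡ; lookup-++ʳ; lookup-replicate; lookup-map; []=⇒lookup; lookup⇒[]=)
open import Function using (_∘_; id)
open import Function.Bundles using (_⇔_; mk⇔; Equivalence)
open import Relation.Binary.PropositionalEquality
open import Relation.Nullary using (¬_; Dec; yes; no; does; contradiction)
open import Relation.Nullary.Decidable using (dec-true; dec-false; _×-dec_; ¬?)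

injective-by : ∀ {A B : Set} {f : A → B} (g : B → A) → (∀ a → g (f a) ≡ a) → ∀ {u v} → f u ≡ f v → u ≡ v
injective-by g g∘f {u} {v} e = trans (sym (g∘f u)) (trans (cong g e) (g∘f v))

tabulate-+ : ∀ {A : Set} m {k} (f : Fin (m + k) → A) →
  tabulate f ≡ tabulate (f ∘ (_↑ˡ k)) ++ tabulate (f ∘ (m ↑ʳ_))
tabulate-+ zero    f = refl
tabulate-+ (suc m) f = cong (f zero ∷_) (tabulate-+ m (f ∘ suc))

∣++∣ : ∀ {m k} (p : Subset m) (q : Subset k) → ∣ p ++ᵛ q ∣ ≡ ∣ p ∣ + ∣ q ∣
∣++∣ []          q = refl
∣++∣ (true ∷ p)  q = cong suc (∣++∣ p q)
∣++∣ (false ∷ p) q = ∣++∣ p q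

bitToFin : Bool → Fin 2
bitToFin false = zero
bitToFin true  = suc zero

finToBit : Fin 2 → Bool
finToBit zero    = false
finToBit (suc _) = true

bitToFin-finToBit : ∀ i → bitToFin (finToBit i) ≡ i
bitToFin-finToBit zero          = refl
bitToFin-finToBit (suc zero)    = refl

finToBit-bitToFin : ∀ b → finToBit (bitToFin b) ≡ b
finToBit-bitToFin false = refl
finToBit-bitToFin true  = refl

bitsToFin : ∀ {k} → Vec Bool k → Fin (2 ^ k)
bitsToFin []      = zero
bitsToFin (b ∷ v) = combine (bitToFin b) (bitsToFin v)

finToBits : ∀ {k} → Fin (2 ^ k) → Vec Bool k
finToBits {zero}  _ = []
finToBits {suc k} i = finToBit (proj₁ q) ∷ finToBits (proj₂ q)
  where q = remQuot (2 ^ k) i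

finToBits-bitsToFin : ∀ {k} (v : Vec Bool k) → finToBits (bitsToFin v) ≡ v
finToBits-bitsToFin []      = refl
finToBits-bitsToFin {suc k} (b ∷ v) = cong₂ _∷_
  (trans (cong (finToBit ∘ proj₁) q≡) (finToBit-bitToFin b))
  (trans (cong (finToBits ∘ proj₂) q≡) (finToBits-bitsToFin v))
  where q≡ = remQuot-combine {2} {2 ^ k} (bitToFin b) (bitsToFin v)

bitsToFin-finToBits : ∀ {k} (i : Fin (2 ^ k)) → bitsToFin (finToBits {k} i) ≡ i
bitsToFin-finToBits {zero}  zero = refl
bitsToFin-finToBits {suc k} i = trans
  (cong₂ combine (bitToFin-finToBit (proj₁ q)) (bitsToFin-finToBits {k} (proj₂ q)))
  (combine-remQuot {2} (2 ^ k) i)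
  where q = remQuot (2 ^ k) i

bits-pigeonhole : ∀ {L M} → L < M → (f : Vec Bool M → Vec Bool L) → ∃₂ λ u v → u ≢ v × f u ≡ f v
bits-pigeonhole {L} {M} L<M f
  with i , j , i<j , eq ← pigeonhole (^-monoʳ-< 2 (s≤s (s≤s z≤n)) L<M) (bitsToFin ∘ f ∘ finToBits {M})
  = finToBits i , finToBits j , <⇒≢ i<j ∘ injective-by bitsToFin (bitsToFin-finToBits {M}) ,
    injective-by finToBits finToBits-bitsToFin eq

-- Cutting a multi-pass run between two halves of the stream

differing-index : ∀ {N} (u v : Vec Bool N) → u ≢ v → ∃ λ i → lookup u i ≢ lookup v i
differing-index []      []      u≢v = contradiction refl u≢v
differing-index (a ∷ u) (b ∷ v) u≢v with a Bool.≟ b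
... | no a≢b  = zero , a≢b
... | yes refl with i , d ← differing-index u v (u≢v ∘ cong (a ∷_)) = suc i , d

module Passes {n p b : ℕ} (A : Algorithm n p b) where

  pass : ℕ → List (Token n) → Vec Bool b → Vec Bool b
  pass i ts s = foldl (λ s t → Algorithm.trans A i t s) s ts

  run : List (Token n) → Vec Bool b
  run ts = runPasses A ts 0 p (init A)

  transcript : List (Token n) → List (Token n) → ℕ → (r : ℕ) → Vec Bool b → Vec Bool (r * (b + b))
  transcript tsA tsB i zero    s = []
  transcript tsA tsB i (suc r) s = (sA ++ᵛ sB) ++ᵛ transcript tsA tsB (suc i) r sB
    where sA = pass i tsA s
          sB = pass i tsB sA

  cut-and-paste : ∀ tsA tsB tsA′ tsB′ i r s →
    transcript tsA tsB i r s ≡ transcript tsA′ tsB′ i r s →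
    runPasses A (tsA ++ tsB′) i r s ≡ runPasses A (tsA ++ tsB) i r s
  cut-and-paste tsA tsB tsA′ tsB′ i zero    s _  = refl
  cut-and-paste tsA tsB tsA′ tsB′ i (suc r) s eq = begin
    runPasses A (tsA ++ tsB′) (suc i) r (pass i (tsA ++ tsB′) s) ≡⟨ cong next (foldl-++ _ s tsA tsB′) ⟩
    runPasses A (tsA ++ tsB′) (suc i) r (pass i tsB′ sA)         ≡⟨ cong next sB′≡sB ⟩
    runPasses A (tsA ++ tsB′) (suc i) r sB                        ≡⟨ cut-and-paste tsA tsB tsA′ tsB′ (suc i) r sB rest≡ ⟩
    runPasses A (tsA ++ tsB) (suc i) r sB                         ≡⟨ cong next (foldl-++ _ s tsA tsB) ⟨
    runPasses A (tsA ++ tsB) (suc i) r (pass i (tsA ++ tsB) s)   ∎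
    where
    open ≡-Reasoning
    next : ∀ {ts} → Vec Bool b → Vec Bool b
    next {ts} = runPasses A ts (suc i) r
    sA = pass i tsA s
    sB = pass i tsB sA
    sA′ = pass i tsA′ s
    sB′ = pass i tsB′ sA′
    halves = ++-injective (sA ++ᵛ sB) (sA′ ++ᵛ sB′) eq
    states = ++-injective sA sA′ (proj₁ halves)
    sB′≡sB : pass i tsB′ sA ≡ sB
    sB′≡sB = trans (cong (pass i tsB′) (proj₁ states)) (sym (proj₂ states))
    rest≡ : transcript tsA tsB (suc i) r sB ≡ transcript tsA′ tsB′ (suc i) r sB
    rest≡ = trans (proj₂ halves) (cong (transcript tsA′ tsB′ (suc i) r) (sym (proj₂ states)))

  fooling-pair : ∀ {N} (tsA tsB : Vec Bool N → List (Token n)) → p * (b + b) < N →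
    ∃₂ λ x x′ → ∃ λ i → lookup x i ≡ true × lookup x′ i ≡ false × run (tsA x ++ tsB x′) ≡ run (tsA x ++ tsB x)
  fooling-pair tsA tsB short
    with u , v , u≢v , same ← bits-pigeonhole short (λ x → transcript (tsA x) (tsB x) 0 p (init A))
    with i , differ ← differing-index u v u≢v
    with lookup u i in uᵢ | lookup v i in vᵢ
  ... | true  | true  = contradiction refl differ
  ... | false | false = contradiction refl differ
  ... | true  | false = u , v , i , uᵢ , vᵢ , cut-and-paste (tsA u) (tsB u) (tsA v) (tsB v) 0 p _ same
  ... | false | true  = v , u , i , vᵢ , uᵢ , cut-and-paste (tsA v) (tsB v) (tsA u) (tsB u) 0 p _ (sym same)

Adjacency : Set → Set
Adjacency V = V → V → Bool

Within2 : ∀ {V : Set} → Adjacency V → V → V → Set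
Within2 E s t = s ≡ t ⊎ E s t ≡ true ⊎ ∃ λ m → E s m ≡ true × E m t ≡ true

module _ {V : Set} {E : Adjacency V} (E-sym : ∀ u v → E u v ≡ E v u) where

  within2-sym : ∀ {s t} → Within2 E s t → Within2 E t s
  within2-sym (inj₁ s≡t)                = inj₁ (sym s≡t)
  within2-sym (inj₂ (inj₁ st))          = inj₂ (inj₁ (trans (E-sym _ _) st))
  within2-sym (inj₂ (inj₂ (m , sm , mt))) = inj₂ (inj₂ (m , trans (E-sym _ _) mt , trans (E-sym _ _) sm))

  within2-via : ∀ {s t} m → s ≡ m ⊎ E s m ≡ true → t ≡ m ⊎ E t m ≡ true → Within2 E s t
  within2-via m (inj₁ refl) (inj₁ refl) = inj₁ refl
  within2-via m (inj₁ refl) (inj₂ tm)   = inj₂ (inj₁ (trans (E-sym _ _) tm))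
  within2-via m (inj₂ sm)   (inj₁ refl) = inj₂ (inj₁ sm)
  within2-via m (inj₂ sm)   (inj₂ tm)   = inj₂ (inj₂ (m , sm , trans (E-sym _ _) tm))

module _ {n : ℕ} (G : Graph n) where

  within2⇒walk : ∀ {s t} → Within2 (adj G) s t → ∃ λ k → k ≤ 2 × Walk G s t k
  within2⇒walk (inj₁ refl)                 = 0 , z≤n , here ∈⊤
  within2⇒walk (inj₂ (inj₁ st))            = 1 , s≤s z≤n , step ∈⊤ st (here ∈⊤)
  within2⇒walk (inj₂ (inj₂ (m , sm , mt))) = 2 , s≤s (s≤s z≤n) , step ∈⊤ sm (step ∈⊤ mt (here ∈⊤))

  walk⇒within2 : ∀ {s t k} → Walk G s t k → k ≤ 2 → Within2 (adj G) s t
  walk⇒within2 (here _)                            _ = inj₁ refl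
  walk⇒within2 (step _ st (here _))                _ = inj₂ (inj₁ st)
  walk⇒within2 (step _ sm (step _ mt (here _)))    _ = inj₂ (inj₂ (_ , sm , mt))
  walk⇒within2 (step _ _ (step _ _ (step _ _ _))) (s≤s (s≤s ()))

  diameter≤2 : (∀ s t → Within2 (adj G) s t) → ∀ {d} → DiameterIs G d → ∃ λ D → d ≡ just D × D ≤ 2
  diameter≤2 close {nothing} (s , t , no-walk) with k , _ , w ← within2⇒walk (close s t) =
    contradiction w (no-walk k)
  diameter≤2 close {just D} (_ , s , t , no-short-walk) with k , k≤2 , w ← within2⇒walk (close s t) =
    D , refl , ≤-trans (≮⇒≥ (λ k<D → no-short-walk k k<D w)) k≤2

  diameter≰2 : ∀ {s t} → ¬ Within2 (adj G) s t → ∀ {D} → D ≤ 2 → ¬ DiameterIs G (just D)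
  diameter≰2 {s} {t} far D≤2 (walks , _) with k , k≤D , w ← walks s t =
    far (walk⇒within2 w (≤-trans k≤D D≤2))

module _ {n : ℕ} {G : Graph n} {S : Subset n} where

  walk-++ : ∀ {s u t k l} → WalkIn G S s u k → WalkIn G S u t l → WalkIn G S s t (k + l)
  walk-++ (here _)        w′ = w′
  walk-++ (step s∈ su w) w′ = step s∈ su (walk-++ w w′)

  walk-snoc : ∀ {s u t k} → WalkIn G S s u k → adj G u t ≡ true → t ∈ S → WalkIn G S s t (suc k)
  walk-snoc (here u∈)       ut t∈ = step u∈ ut (here t∈)
  walk-snoc (step s∈ sm w) ut t∈ = step s∈ sm (walk-snoc w ut t∈)

  walk-reverse : ∀ {s t k} → WalkIn G S s t k → WalkIn G S t s k
  walk-reverse (here s∈)       = here s∈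
  walk-reverse (step s∈ su w) = walk-snoc (walk-reverse w) (trans (Graph.sym G _ _) su) s∈

neighbours : ∀ {n} → (Fin n → Bool) → List (Fin n)
neighbours row = filter (λ u → row u Bool.≟ true) (allFin _)

neighbours-unique : ∀ {n} (row : Fin n → Bool) → Unique (neighbours row)
neighbours-unique row = filter⁺ (λ u → row u Bool.≟ true) (allFin⁺ _)

∈-neighbours : ∀ {n} (row : Fin n → Bool) u → u ∈ₗ neighbours row ⇔ row u ≡ true
∈-neighbours row u = mk⇔ (λ u∈ → proj₂ (∈-filter⁻ row? {xs = allFin _} u∈)) (∈-filter⁺ row? (∈-allFin u))
  where row? = λ u → row u Bool.≟ true

neighbours-valid : ∀ {n} (G : Graph n) v (row : Fin n → Bool) → (∀ u → row u ≡ adj G v u) →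
  Unique (neighbours row) × (∀ u → u ∈ₗ neighbours row ⇔ adj G v u ≡ true)
neighbours-valid G v row row≗adj = neighbours-unique row , λ u →
  mk⇔ (λ u∈ → trans (sym (row≗adj u)) (Equivalence.to (∈-neighbours row u) u∈))
      (λ vu → Equivalence.from (∈-neighbours row u) (trans (row≗adj u) vu))

-- Induced patterns

-- Distinctness conditions are stated only where an irreflexive adjacency does not already force them.
module _ {V : Set} (E : Adjacency V) where

  HasP₃ HasK₃ Has3P₁ : Set
  HasP₃  = ∃[ i ] ∃[ j ] ∃[ k ] i ≢ k × E i j ≡ true × E j k ≡ true × E i k ≡ false
  HasK₃  = ∃[ i ] ∃[ j ] ∃[ k ] E i j ≡ true × E j k ≡ true × E i k ≡ true
  Has3P₁ = ∃[ i ] ∃[ j ] ∃[ k ] (i ≢ j × j ≢ k × i ≢ k) × E i j ≡ false × E j k ≡ false × E i k ≡ false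

  Has4P₁ Has2K₂ HasP₄ HasC₄ : Set
  Has4P₁ = ∃[ i ] ∃[ j ] ∃[ k ] ∃[ l ] (i ≢ j × i ≢ k × i ≢ l × j ≢ k × j ≢ l × k ≢ l) ×
             (E i j ≡ false × E i k ≡ false × E i l ≡ false × E j k ≡ false × E j l ≡ false × E k l ≡ false)
  Has2K₂ = ∃[ i ] ∃[ j ] ∃[ k ] ∃[ l ] E i j ≡ true × E k l ≡ true ×
             E i k ≡ false × E i l ≡ false × E j k ≡ false × E j l ≡ false
  HasP₄  = ∃[ i ] ∃[ j ] ∃[ k ] ∃[ l ] E i j ≡ true × E j k ≡ true × E k l ≡ true ×
             E i k ≡ false × E i l ≡ false × E j l ≡ false
  HasC₄  = ∃[ i ] ∃[ j ] ∃[ k ] ∃[ l ] i ≢ k × j ≢ l × E i j ≡ true × E j k ≡ true × E k l ≡ true × E l i ≡ true ×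
             E i k ≡ false × E j l ≡ false

record Embedding {V W : Set} (E : Adjacency V) (E′ : Adjacency W) : Set where
  field
    apply         : V → W
    injective     : ∀ {u v} → apply u ≡ apply v → u ≡ v
    preserves-adj : ∀ u v → E′ (apply u) (apply v) ≡ E u v

Hereditary : (∀ {V : Set} → Adjacency V → Set) → Set₁
Hereditary P = ∀ {V W : Set} {E : Adjacency V} {E′ : Adjacency W} → Embedding E E′ → P E → P E′

module _ {V W : Set} {E : Adjacency V} {E′ : Adjacency W} (φ : Embedding E E′) where
  open Embedding φ

  private
    ↑ : ∀ {u v b} → E u v ≡ b → E′ (apply u) (apply v) ≡ b
    ↑ {u} {v} e = trans (preserves-adj u v) e
    ↑≢ : ∀ {u v} → u ≢ v → apply u ≢ apply v
    ↑≢ u≢v = u≢v ∘ injective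

  P₃-hereditary : HasP₃ E → HasP₃ E′
  P₃-hereditary (i , j , k , i≢k , ij , jk , ik) = apply i , apply j , apply k , ↑≢ i≢k , ↑ ij , ↑ jk , ↑ ik

  K₃-hereditary : HasK₃ E → HasK₃ E′
  K₃-hereditary (i , j , k , ij , jk , ik) = apply i , apply j , apply k , ↑ ij , ↑ jk , ↑ ik

  3P₁-hereditary : Has3P₁ E → Has3P₁ E′
  3P₁-hereditary (i , j , k , (i≢j , j≢k , i≢k) , ij , jk , ik) =
    apply i , apply j , apply k , (↑≢ i≢j , ↑≢ j≢k , ↑≢ i≢k) , ↑ ij , ↑ jk , ↑ ik

  2K₂-hereditary : Has2K₂ E → Has2K₂ E′
  2K₂-hereditary (i , j , k , l , ij , kl , ik , il , jk , jl) =
    apply i , apply j , apply k , apply l , ↑ ij , ↑ kl , ↑ ik , ↑ il , ↑ jk , ↑ jl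

  P₄-hereditary : HasP₄ E → HasP₄ E′
  P₄-hereditary (i , j , k , l , ij , jk , kl , ik , il , jl) =
    apply i , apply j , apply k , apply l , ↑ ij , ↑ jk , ↑ kl , ↑ ik , ↑ il , ↑ jl

  C₄-hereditary : HasC₄ E → HasC₄ E′
  C₄-hereditary (i , j , k , l , i≢k , j≢l , ij , jk , kl , li , ik , jl) =
    apply i , apply j , apply k , apply l , ↑≢ i≢k , ↑≢ j≢l , ↑ ij , ↑ jk , ↑ kl , ↑ li , ↑ ik , ↑ jl

  4P₁-hereditary : Has4P₁ E → Has4P₁ E′
  4P₁-hereditary (i , j , k , l , (i≢j , i≢k , i≢l , j≢k , j≢l , k≢l) , (ij , ik , il , jk , jl , kl)) =
    apply i , apply j , apply k , apply l , (↑≢ i≢j , ↑≢ i≢k , ↑≢ i≢l , ↑≢ j≢k , ↑≢ j≢l , ↑≢ k≢l) ,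
    (↑ ij , ↑ ik , ↑ il , ↑ jk , ↑ jl , ↑ kl)


4P₁⇒3P₁ : ∀ {V} {E : Adjacency V} → Has4P₁ E → Has3P₁ E
4P₁⇒3P₁ (i , j , k , _ , (i≢j , i≢k , _ , j≢k , _) , (ij , ik , _ , jk , _)) =
  i , j , k , (i≢j , j≢k , i≢k) , ij , jk , ik

clash : ∀ {b : Bool} → b ≡ true → b ≡ false → ⊥
clash refl ()

≢-both-≡-not : ∀ {a b c : Bool} → a ≢ b → c ≢ b → a ≡ c
≢-both-≡-not a≢b c≢b = trans (Bool.¬-not a≢b) (sym (Bool.¬-not c≢b))

module _ {V : Set} {E : Adjacency V} (E-sym : ∀ u v → E u v ≡ E v u) where

  P₃-free-if-unique-neighbours : (∀ {u v w} → E u v ≡ true → E u w ≡ true → v ≡ w) → ¬ HasP₃ E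
  P₃-free-if-unique-neighbours unique (i , j , k , i≢k , ij , jk , _) = i≢k (unique (trans (E-sym j i) ij) jk)

  K₃-free-if-bipartite : (colour : V → Bool) → (∀ {u v} → E u v ≡ true → colour u ≢ colour v) → ¬ HasK₃ E
  K₃-free-if-bipartite colour proper (i , j , k , ij , jk , ik) =
    proper ik (≢-both-≡-not (proper ij) (proper (trans (E-sym k j) jk)))

  3P₁-free-if-two-cliques : (side : V → Bool) → (∀ {u v} → side u ≡ side v → u ≢ v → E u v ≡ true) → ¬ Has3P₁ E
  3P₁-free-if-two-cliques side clique (i , j , k , (i≢j , j≢k , i≢k) , ij , jk , ik)
    with side i Bool.≟ side j | side k Bool.≟ side j
  ... | yes i∼j | _       = clash (clique i∼j i≢j) ij
  ... | _       | yes k∼j = clash (clique k∼j (j≢k ∘ sym)) (trans (E-sym k j) jk)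
  ... | no i≁j  | no k≁j  = clash (clique (≢-both-≡-not i≁j k≁j) i≢k) ik

  module _ (inK : V → Bool)
           (clique : ∀ {u v} → inK u ≡ true → inK v ≡ true → u ≢ v → E u v ≡ true)
           (cover : ∀ {u v} → E u v ≡ true → inK u ≡ true ⊎ inK v ≡ true) where

    2K₂-free-if-split : ¬ Has2K₂ E
    2K₂-free-if-split (i , j , k , l , ij , kl , ik , il , jk , jl) with cover ij | cover kl
    ... | inj₁ i∈ | inj₁ k∈ = clash (clique i∈ k∈ λ { refl → clash kl il }) ik
    ... | inj₁ i∈ | inj₂ l∈ = clash (clique i∈ l∈ λ { refl → clash kl (trans (E-sym k i) ik) }) il
    ... | inj₂ j∈ | inj₁ k∈ = clash (clique j∈ k∈ λ { refl → clash ij ik }) jk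
    ... | inj₂ j∈ | inj₂ l∈ = clash (clique j∈ l∈ λ { refl → clash kl (trans (E-sym k j) jk) }) jl

    private
      outside-of-non-edge : ∀ {u v} → u ≢ v → E u v ≡ false → inK u ≡ false ⊎ inK v ≡ false
      outside-of-non-edge {u} {v} u≢v uv with inK u in u∈ | inK v in v∈
      ... | false | _     = inj₁ refl
      ... | true  | false = inj₂ refl
      ... | true  | true  = contradiction (clique u∈ v∈ u≢v) λ e → clash e uv

      no-edge-outside : ∀ {u v} → inK u ≡ false → inK v ≡ false → E u v ≡ true → ⊥
      no-edge-outside u∉ v∉ uv with cover uv
      ... | inj₁ u∈ = clash u∈ u∉
      ... | inj₂ v∈ = clash v∈ v∉

    C₄-free-if-split : ¬ HasC₄ E
    C₄-free-if-split (i , j , k , l , i≢k , j≢l , ij , jk , kl , li , ik , jl)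
      with outside-of-non-edge i≢k ik | outside-of-non-edge j≢l jl
    ... | inj₁ i∉ | inj₁ j∉ = no-edge-outside i∉ j∉ ij
    ... | inj₁ i∉ | inj₂ l∉ = no-edge-outside l∉ i∉ li
    ... | inj₂ k∉ | inj₁ j∉ = no-edge-outside j∉ k∉ jk
    ... | inj₂ k∉ | inj₂ l∉ = no-edge-outside k∉ l∉ kl

  P₄-free-if-apex-over-matching : (o : V) → (∀ v → v ≡ o ⊎ E o v ≡ true) →
    (∀ {u v w} → E o u ≡ true → E u v ≡ true → E u w ≡ true → v ≡ o ⊎ w ≡ o ⊎ v ≡ w) → ¬ HasP₄ E
  P₄-free-if-apex-over-matching o apex matching (i , j , k , l , ij , jk , kl , ik , il , jl) with apex j
  ... | inj₁ refl with apex l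
  ...   | inj₁ refl = clash ij il
  ...   | inj₂ jl′  = clash jl′ jl
  P₄-free-if-apex-over-matching o apex matching (i , j , k , l , ij , jk , kl , ik , il , jl)
      | inj₂ oj with matching oj (trans (E-sym j i) ij) jk
  ... | inj₂ (inj₂ refl) = clash kl il
  ... | inj₁ refl with apex k
  ...   | inj₁ refl = clash kl il
  ...   | inj₂ ok   = clash ok ik
  P₄-free-if-apex-over-matching o apex matching (i , j , k , l , ij , jk , kl , ik , il , jl)
      | inj₂ oj | inj₂ (inj₁ refl) with apex i
  ...   | inj₁ refl = clash kl il
  ...   | inj₂ oi   = clash oi (trans (E-sym k i) ik)

-- Recognising sP₁, P₂ + sP₁ and P₃

iso-from-enumeration : ∀ {k m} {H : Graph m} {K : Graph k} (g : Fin k → Fin m) →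
  (∀ {a b} → g a ≡ g b → a ≡ b) → (∀ w → ∃ λ a → g a ≡ w) →
  (∀ a b → adj H (g a) (g b) ≡ adj K a b) → Iso H K
iso-from-enumeration {H = H} g injective cover g-adj = record
  { to      = proj₁ ∘ cover
  ; from    = g
  ; from∘to = proj₂ ∘ cover
  ; to∘from = λ a → injective (proj₂ (cover (g a)))
  ; pres    = λ u v → trans (sym (g-adj _ _)) (cong₂ (adj H) (proj₂ (cover u)) (proj₂ (cover v)))
  }

edgeless-iso : ∀ {m} (H : Graph m) → (∀ u v → adj H u v ≡ false) → Iso H (edgeless m)
edgeless-iso H no-edge = iso-from-enumeration id id (λ w → w , refl) no-edge

transpose-matchˡ : ∀ {n} (i j : Fin n) → transpose i j i ≡ j
transpose-matchˡ i j rewrite dec-true (i ≟ i) refl = refl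

transpose-fix : ∀ {n} {i j k : Fin n} → k ≢ i → k ≢ j → transpose i j k ≡ k
transpose-fix {i = i} {j} {k} k≢i k≢j rewrite dec-false (k ≟ i) k≢i | dec-false (k ≟ j) k≢j = refl

module _ {s : ℕ} {i j : Fin (2 + s)} (i≢j : i ≢ j) where

  private
    j′ : Fin (2 + s)
    j′ = transpose i zero j

    j′≢0 : j′ ≢ zero
    j′≢0 j′≡0 = i≢j (begin
      i                                     ≡⟨ transpose-matchˡ zero i ⟨
      transpose zero i zero                 ≡⟨ cong (transpose zero i) j′≡0 ⟨
      transpose zero i (transpose i zero j) ≡⟨ transpose-inverse zero i {j} ⟩
      j                                     ∎)
      where open ≡-Reasoning

  place : Fin (2 + s) → Fin (2 + s)
  place a = transpose zero i (transpose (suc zero) j′ a)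

  unplace : Fin (2 + s) → Fin (2 + s)
  unplace w = transpose j′ (suc zero) (transpose i zero w)

  unplace-place : ∀ a → unplace (place a) ≡ a
  unplace-place a = trans (cong (transpose j′ (suc zero)) (transpose-inverse i zero {transpose (suc zero) j′ a}))
                          (transpose-inverse j′ (suc zero) {a})

  place-unplace : ∀ w → place (unplace w) ≡ w
  place-unplace w = trans (cong (transpose zero i) (transpose-inverse (suc zero) j′ {transpose i zero w}))
                          (transpose-inverse zero i {w})

  place-injective : ∀ {a b} → place a ≡ place b → a ≡ b
  place-injective = injective-by unplace unplace-place

  place-0 : place zero ≡ i
  place-0 = trans (cong (transpose zero i) (transpose-fix {i = suc zero} {j′} (λ ()) (j′≢0 ∘ sym)))
                  (transpose-matchˡ zero i)

  place-1 : place (suc zero) ≡ j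
  place-1 = trans (cong (transpose zero i) (transpose-matchˡ (suc zero) j′)) (transpose-inverse zero i {j})

Iso⇒Embedding : ∀ {m k} {H : Graph m} {K : Graph k} → Iso H K → Embedding (adj K) (adj H)
Iso⇒Embedding {H = H} {K} ι = record
  { apply         = from
  ; injective     = injective-by to to∘from
  ; preserves-adj = λ a b → trans (sym (pres (from a) (from b))) (cong₂ (adj K) (to∘from a) (to∘from b))
  }
  where open Iso ι

true-iff⇒≡ : ∀ {a b : Bool} → (a ≡ true → b ≡ true) → (b ≡ true → a ≡ true) → a ≡ b
true-iff⇒≡ {true}  a⇒b _   = sym (a⇒b refl)
true-iff⇒≡ {false} {true}  _ b⇒a = b⇒a refl
true-iff⇒≡ {false} {false} _ _   = refl

flip-adj : ∀ {m} (H : Graph m) {u v b} → adj H u v ≡ b → adj H v u ≡ b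
flip-adj H {u} {v} e = trans (Graph.sym H v u) e

adjacent⇒≢ : ∀ {m} (H : Graph m) {u v} → adj H u v ≡ true → u ≢ v
adjacent⇒≢ H {u} uv refl = clash uv (Graph.irrefl H u)

P₂-edge : ∀ {s} {a b : Fin (2 + s)} → p2adj a b ≡ true → (a ≡ zero × b ≡ suc zero) ⊎ (a ≡ suc zero × b ≡ zero)
P₂-edge {a = zero}        {suc zero}     _ = inj₁ (refl , refl)
P₂-edge {a = suc zero}    {zero}         _ = inj₂ (refl , refl)
P₂-edge {a = zero}        {zero}         ()
P₂-edge {a = zero}        {suc (suc _)}  ()
P₂-edge {a = suc zero}    {suc _}        ()
P₂-edge {a = suc (suc _)} {_}            ()

OnlyEdge : ∀ {m} → Graph m → Fin m → Fin m → Set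
OnlyEdge H i j = ∀ {u v} → adj H u v ≡ true → (u ≡ i × v ≡ j) ⊎ (u ≡ j × v ≡ i)

single-edge-iso : ∀ {s} (H : Graph (2 + s)) {i j} → adj H i j ≡ true → OnlyEdge H i j → Iso H (P₂+ s P₁)
single-edge-iso H {i} {j} ij only =
  iso-from-enumeration (place i≢j) (place-injective i≢j) (λ w → unplace i≢j w , place-unplace i≢j w) place-adj
  where
  i≢j = adjacent⇒≢ H ij
  at-0 : ∀ {a} → place i≢j a ≡ i → a ≡ zero
  at-0 e = place-injective i≢j (trans e (sym (place-0 i≢j)))
  at-1 : ∀ {a} → place i≢j a ≡ j → a ≡ suc zero
  at-1 e = place-injective i≢j (trans e (sym (place-1 i≢j)))
  place-adj : ∀ a b → adj H (place i≢j a) (place i≢j b) ≡ p2adj a b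
  place-adj a b = true-iff⇒≡ placed-edge edge-placed
    where
    placed-edge : adj H (place i≢j a) (place i≢j b) ≡ true → p2adj a b ≡ true
    placed-edge e with only e
    ... | inj₁ (ai , bj) rewrite at-0 {a} ai | at-1 {b} bj = refl
    ... | inj₂ (aj , bi) rewrite at-1 {a} aj | at-0 {b} bi = refl
    edge-placed : p2adj a b ≡ true → adj H (place i≢j a) (place i≢j b) ≡ true
    edge-placed e with P₂-edge e
    ... | inj₁ (refl , refl) rewrite place-0 i≢j | place-1 i≢j = ij
    ... | inj₂ (refl , refl) rewrite place-0 i≢j | place-1 i≢j = flip-adj H ij

P₂+3P₁-has-4P₁ : ∀ {s} → Has4P₁ (adj (P₂+ (3 + s) P₁))
P₂+3P₁-has-4P₁ = zero , suc (suc zero) , suc (suc (suc zero)) , suc (suc (suc (suc zero))) ,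
  ((λ ()) , (λ ()) , (λ ()) , (λ ()) , (λ ()) , (λ ())) , (refl , refl , refl , refl , refl , refl)

module _ {m : ℕ} (H : Graph m) where
  private
    E = adj H

  P₃? : Dec (HasP₃ E)
  P₃? = any? λ i → any? λ j → any? λ k →
    ¬? (i ≟ k) ×-dec E i j Bool.≟ true ×-dec E j k Bool.≟ true ×-dec E i k Bool.≟ false

  K₃? : Dec (HasK₃ E)
  K₃? = any? λ i → any? λ j → any? λ k → E i j Bool.≟ true ×-dec E j k Bool.≟ true ×-dec E i k Bool.≟ true

  2K₂? : Dec (Has2K₂ E)
  2K₂? = any? λ i → any? λ j → any? λ k → any? λ l → E i j Bool.≟ true ×-dec E k l Bool.≟ true ×-dec
    E i k Bool.≟ false ×-dec E i l Bool.≟ false ×-dec E j k Bool.≟ false ×-dec E j l Bool.≟ false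

  4P₁? : Dec (Has4P₁ E)
  4P₁? = any? λ i → any? λ j → any? λ k → any? λ l →
    (¬? (i ≟ j) ×-dec ¬? (i ≟ k) ×-dec ¬? (i ≟ l) ×-dec ¬? (j ≟ k) ×-dec ¬? (j ≟ l) ×-dec ¬? (k ≟ l)) ×-dec
    (E i j Bool.≟ false ×-dec E i k Bool.≟ false ×-dec E i l Bool.≟ false ×-dec
     E j k Bool.≟ false ×-dec E j l Bool.≟ false ×-dec E k l Bool.≟ false)

  module _ (noP₃ : ¬ HasP₃ E) (noK₃ : ¬ HasK₃ E) where

    non-neighbour : ∀ {a b w} → E a b ≡ true → w ≢ b → E w a ≡ false
    non-neighbour {a} {b} {w} ab w≢b with E w a in wa | E w b in wb
    ... | false | _     = refl
    ... | true  | true  = ⊥-elim (noK₃ (w , a , b , wa , ab , wb))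
    ... | true  | false = ⊥-elim (noP₃ (w , a , b , w≢b , wa , ab , wb))

    neighbour-of-edge : ∀ {a b w} → E a b ≡ true → E w a ≡ true → w ≡ b
    neighbour-of-edge {b = b} {w} ab wa with w ≟ b
    ... | yes w≡b = w≡b
    ... | no  w≢b = ⊥-elim (clash wa (non-neighbour ab w≢b))

    only-edge : ¬ Has2K₂ E → ∀ {i j} → E i j ≡ true → OnlyEdge H i j
    only-edge no2K₂ {i} {j} ij {u} {v} uv with u ≟ i | u ≟ j
    ... | yes refl | _        = inj₁ (refl , neighbour-of-edge ij (flip-adj H uv))
    ... | no _     | yes refl = inj₂ (refl , neighbour-of-edge (flip-adj H ij) (flip-adj H uv))
    ... | no u≢i   | no u≢j   = ⊥-elim (no2K₂ (u , v , i , j , uv , ij , ui , uj ,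
                                  non-neighbour ij (λ { refl → clash uv uj }) ,
                                  non-neighbour ji (λ { refl → clash uv ui })))
      where
      ji = flip-adj H ij
      ui = non-neighbour ij u≢j
      uj = non-neighbour ji u≢i

Not-P₂+sP₁ Not-sP₁ : ∀ {m} → Graph m → Set
Not-P₂+sP₁ H = ∀ s → s ≤ 2 → ¬ Iso H (P₂+ s P₁)
Not-sP₁    H = ∀ s → 1 ≤ s → s ≤ 3 → ¬ Iso H (edgeless s)

edgeless-excluded : ∀ {m} (H : Graph m) → 1 ≤ m → Not-sP₁ H → ¬ Has4P₁ (adj H) → ¬ (∀ u v → adj H u v ≡ false)
edgeless-excluded {1} H _ notE _ no-edge = notE 1 (s≤s z≤n) (s≤s z≤n) (edgeless-iso H no-edge)
edgeless-excluded {2} H _ notE _ no-edge = notE 2 (s≤s z≤n) (s≤s (s≤s z≤n)) (edgeless-iso H no-edge)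
edgeless-excluded {3} H _ notE _ no-edge = notE 3 (s≤s z≤n) (s≤s (s≤s (s≤s z≤n))) (edgeless-iso H no-edge)
edgeless-excluded {suc (suc (suc (suc _)))} H _ _ no4P₁ no-edge = no4P₁
  (zero , suc zero , suc (suc zero) , suc (suc (suc zero)) , ((λ ()) , (λ ()) , (λ ()) , (λ ()) , (λ ()) , (λ ())) ,
   (no-edge _ _ , no-edge _ _ , no-edge _ _ , no-edge _ _ , no-edge _ _ , no-edge _ _))

single-edge-excluded : ∀ {m} (H : Graph m) → Not-P₂+sP₁ H → ¬ Has4P₁ (adj H) →
  ∀ {i j} → adj H i j ≡ true → ¬ OnlyEdge H i j
single-edge-excluded {1} H _ _ {zero} {zero} ij _ = adjacent⇒≢ H ij refl
single-edge-excluded {2} H notP₂ _ ij only = notP₂ 0 z≤n (single-edge-iso H ij only)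
single-edge-excluded {3} H notP₂ _ ij only = notP₂ 1 (s≤s z≤n) (single-edge-iso H ij only)
single-edge-excluded {4} H notP₂ _ ij only = notP₂ 2 (s≤s (s≤s z≤n)) (single-edge-iso H ij only)
single-edge-excluded {suc (suc (suc (suc (suc _))))} H _ no4P₁ ij only =
  no4P₁ (4P₁-hereditary (Iso⇒Embedding (single-edge-iso H ij only)) P₂+3P₁-has-4P₁)

excluded-small-graph : ∀ {m} (H : Graph m) → 1 ≤ m → Not-P₂+sP₁ H → Not-sP₁ H →
  ¬ HasP₃ (adj H) → ¬ HasK₃ (adj H) → ¬ Has2K₂ (adj H) → ¬ Has4P₁ (adj H) → ⊥
excluded-small-graph H 1≤m notP₂ notE noP₃ noK₃ no2K₂ no4P₁ with any? (λ i → any? λ j → adj H i j Bool.≟ true)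
... | no no-edge     = edgeless-excluded H 1≤m notE no4P₁ λ u v → Bool.¬-not λ uv → no-edge (u , v , uv)
... | yes (i , j , ij) = single-edge-excluded H notP₂ no4P₁ ij (only-edge H noP₃ noK₃ no2K₂ ij)

P₃-extension : ∀ {m} (H : Graph m) {i j k} → i ≢ k → adj H i j ≡ true → adj H j k ≡ true → adj H i k ≡ false →
  ∀ {w} → w ≢ i → w ≢ j → w ≢ k → HasK₃ (adj H) ⊎ Has3P₁ (adj H) ⊎ HasP₄ (adj H) ⊎ HasC₄ (adj H)
P₃-extension H {i} {j} {k} i≢k ij jk ik {w} w≢i w≢j w≢k with adj H w i in wi | adj H w j in wj | adj H w k in wk
... | true  | true  | _     = inj₁ (w , i , j , wi , ij , wj)
... | _     | true  | true  = inj₁ (w , j , k , wj , jk , wk)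
... | true  | false | true  = inj₂ (inj₂ (inj₂ (i , j , k , w , i≢k , w≢j ∘ sym , ij , jk , kw , wi , ik , jw)))
  where kw = flip-adj H wk
        jw = flip-adj H wj
... | true  | false | false = inj₂ (inj₂ (inj₁ (w , i , j , k , wi , ij , jk , wj , wk , ik)))
... | false | false | true  = inj₂ (inj₂ (inj₁ (i , j , k , w , ij , jk , kw , ik , iw , jw)))
  where kw = flip-adj H wk
        iw = flip-adj H wi
        jw = flip-adj H wj
... | false | _     | false = inj₂ (inj₁ (i , k , w , (i≢k , w≢k ∘ sym , w≢i ∘ sym) , ik , kw , iw))
  where kw = flip-adj H wk
        iw = flip-adj H wi

P₃-iso : ∀ {m} (H : Graph m) {i j k} → i ≢ k → adj H i j ≡ true → adj H j k ≡ true → adj H i k ≡ false →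
  (∀ w → w ≡ i ⊎ w ≡ j ⊎ w ≡ k) → Iso H P₃
P₃-iso {m} H {i} {j} {k} i≢k ij jk ik cover = iso-from-enumeration g g-injective g-cover g-adj
  where
  g : Fin 3 → Fin m
  g zero             = i
  g (suc zero)       = j
  g (suc (suc zero)) = k

  i≢j = adjacent⇒≢ H ij
  j≢k = adjacent⇒≢ H jk

  g-injective : ∀ {a b} → g a ≡ g b → a ≡ b
  g-injective {zero}             {zero}             _ = refl
  g-injective {zero}             {suc zero}         e = ⊥-elim (i≢j e)
  g-injective {zero}             {suc (suc zero)}   e = ⊥-elim (i≢k e)
  g-injective {suc zero}         {zero}             e = ⊥-elim (i≢j (sym e))
  g-injective {suc zero}         {suc zero}         _ = refl
  g-injective {suc zero}         {suc (suc zero)}   e = ⊥-elim (j≢k e)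
  g-injective {suc (suc zero)}   {zero}             e = ⊥-elim (i≢k (sym e))
  g-injective {suc (suc zero)}   {suc zero}         e = ⊥-elim (j≢k (sym e))
  g-injective {suc (suc zero)}   {suc (suc zero)}   _ = refl

  g-cover : ∀ w → ∃ λ a → g a ≡ w
  g-cover w with cover w
  ... | inj₁ w≡i        = zero , sym w≡i
  ... | inj₂ (inj₁ w≡j) = suc zero , sym w≡j
  ... | inj₂ (inj₂ w≡k) = suc (suc zero) , sym w≡k

  g-adj : ∀ a b → adj H (g a) (g b) ≡ p3adj a b
  g-adj zero             zero             = Graph.irrefl H i
  g-adj zero             (suc zero)       = ij
  g-adj zero             (suc (suc zero)) = ik
  g-adj (suc zero)       zero             = flip-adj H ij
  g-adj (suc zero)       (suc zero)       = Graph.irrefl H j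
  g-adj (suc zero)       (suc (suc zero)) = jk
  g-adj (suc (suc zero)) zero             = flip-adj H ik
  g-adj (suc (suc zero)) (suc zero)       = flip-adj H jk
  g-adj (suc (suc zero)) (suc (suc zero)) = Graph.irrefl H k

three-cover : ∀ {m} {i j k : Fin m} → ¬ (∃ λ w → w ≢ i × w ≢ j × w ≢ k) → ∀ w → w ≡ i ⊎ w ≡ j ⊎ w ≡ k
three-cover {i = i} {j} {k} none w with w ≟ i | w ≟ j | w ≟ k
... | yes w≡i | _       | _       = inj₁ w≡i
... | no _    | yes w≡j | _       = inj₂ (inj₁ w≡j)
... | no _    | no _    | yes w≡k = inj₂ (inj₂ w≡k)
... | no w≢i  | no w≢j  | no w≢k  = ⊥-elim (none (w , w≢i , w≢j , w≢k))

contains-P₃-K₃-2K₂-or-3P₁ : ∀ {m} (H : Graph m) → 1 ≤ m → Not-P₂+sP₁ H → Not-sP₁ H →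
  HasP₃ (adj H) ⊎ HasK₃ (adj H) ⊎ Has2K₂ (adj H) ⊎ Has3P₁ (adj H)
contains-P₃-K₃-2K₂-or-3P₁ H 1≤m notP₂ notE with P₃? H | K₃? H | 2K₂? H | 4P₁? H
... | yes p₃ | _      | _      | _      = inj₁ p₃
... | no _   | yes k₃ | _      | _      = inj₂ (inj₁ k₃)
... | no _   | no _   | yes t  | _      = inj₂ (inj₂ (inj₁ t))
... | no _   | no _   | no _   | yes f  = inj₂ (inj₂ (inj₂ (4P₁⇒3P₁ f)))
... | no noP₃ | no noK₃ | no no2K₂ | no no4P₁ =
  ⊥-elim (excluded-small-graph H 1≤m notP₂ notE noP₃ noK₃ no2K₂ no4P₁)

contains-K₃-2K₂-3P₁-P₄-or-C₄ : ∀ {m} (H : Graph m) → 1 ≤ m → Not-P₂+sP₁ H → Not-sP₁ H → ¬ Iso H P₃ →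
  HasK₃ (adj H) ⊎ Has2K₂ (adj H) ⊎ Has3P₁ (adj H) ⊎ HasP₄ (adj H) ⊎ HasC₄ (adj H)
contains-K₃-2K₂-3P₁-P₄-or-C₄ H 1≤m notP₂ notE notP₃ with K₃? H | 2K₂? H | 4P₁? H
... | yes k₃ | _     | _     = inj₁ k₃
... | no _   | yes t | _     = inj₂ (inj₁ t)
... | no _   | no _  | yes f = inj₂ (inj₂ (inj₁ (4P₁⇒3P₁ f)))
... | no noK₃ | no no2K₂ | no no4P₁ with P₃? H
...   | no noP₃ = ⊥-elim (excluded-small-graph H 1≤m notP₂ notE noP₃ noK₃ no2K₂ no4P₁)
...   | yes (i , j , k , i≢k , ij , jk , ik) with any? (λ w → ¬? (w ≟ i) ×-dec ¬? (w ≟ j) ×-dec ¬? (w ≟ k))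
...     | yes (w , w≢i , w≢j , w≢k) = [ inj₁ , inj₂ ∘ inj₂ ]′ (P₃-extension H i≢k ij jk ik w≢i w≢j w≢k)
...     | no none = ⊥-elim (notP₃ (P₃-iso H i≢k ij jk ik (three-cover none)))

-- The construction

_==_ : ∀ {N} → Fin N → Fin N → Bool
i == j = does (i ≟ j)

==-refl : ∀ {N} (i : Fin N) → (i == i) ≡ true
==-refl i = dec-true (i ≟ i) refl

==-sym : ∀ {N} (i j : Fin N) → (i == j) ≡ (j == i)
==-sym i j with i ≟ j | j ≟ i
... | yes _ | yes _ = refl
... | no _  | no _  = refl
... | yes e | no n  = contradiction (sym e) n
... | no n  | yes e = contradiction (sym e) n

==-false : ∀ {N} {i j : Fin N} → i ≢ j → (i == j) ≡ false
==-false {i = i} {j} i≢j = dec-false (i ≟ j) i≢j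

==⇒≡ : ∀ {N} (i j : Fin N) → (i == j) ≡ true → i ≡ j
==⇒≡ i j e with i ≟ j
... | yes i≡j = i≡j

-- Which of the edge sets {aᵢaⱼ}, {bᵢbⱼ}, {r aᵢ}, {r bᵢ} are present; all other edges are fixed.
record Flags : Set where
  constructor flags
  field
    a-clique b-clique r-a r-b : Bool
open Flags

AliceVertex : ℕ → ℕ → Set
AliceVertex N t = Fin N ⊎ Fin (3 + t)

BobVertex : ℕ → Set
BobVertex N = Fin N ⊎ Fin 1

Vertex : ℕ → ℕ → Set
Vertex N t = AliceVertex N t ⊎ BobVertex N

-- Alice's vertices a i, c, h, r, pad k and Bob's vertices b i, z; the two families share patterns.
pattern a i   = inj₁ i
pattern c     = inj₂ zero
pattern h     = inj₂ (suc zero)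
pattern r     = inj₂ (suc (suc zero))
pattern pad k = inj₂ (suc (suc (suc k)))
pattern b i   = inj₁ i
pattern z     = inj₂ zero

data Core (N : ℕ) : Set where
  aᶜ bᶜ : Fin N → Core N
  rᶜ    : Core N

module Layout (N t : ℕ) where

  nA nB n : ℕ
  nA = N + (3 + t)
  nB = N + 1
  n  = nA + nB

  decode : Fin n → Vertex N t
  decode v = Sum.map (splitAt N) (splitAt N) (splitAt nA v)

  encode : Vertex N t → Fin n
  encode w = join nA nB (Sum.map (join N (3 + t)) (join N 1) w)

  decode-encode : ∀ w → decode (encode w) ≡ w
  decode-encode (inj₁ u) rewrite splitAt-join nA nB (inj₁ (join N (3 + t) u)) =
    cong inj₁ (splitAt-join N (3 + t) u)
  decode-encode (inj₂ u) rewrite splitAt-join nA nB (inj₂ (join N 1 u)) =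
    cong inj₂ (splitAt-join N 1 u)

  encode-decode : ∀ v → encode (decode v) ≡ v
  encode-decode v = trans (cong (join nA nB) (rejoin (splitAt nA v))) (join-splitAt nA nB v)
    where
    rejoin : ∀ s → Sum.map (join N (3 + t)) (join N 1) (Sum.map (splitAt N) (splitAt N) s) ≡ s
    rejoin (inj₁ u) = cong inj₁ (join-splitAt N (3 + t) u)
    rejoin (inj₂ u) = cong inj₂ (join-splitAt N 1 u)

  decode-injective : ∀ {u v} → decode u ≡ decode v → u ≡ v
  decode-injective = injective-by encode encode-decode

  hubsX : Subset (3 + t)
  hubsX = true ∷ true ∷ false ∷ full

  aliceX : Subset nA
  aliceX = ∅ {N} ++ᵛ hubsX

  bobX : Subset nB
  bobX = ∅ {N} ++ᵛ (true ∷ [])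

  X : Subset n
  X = aliceX ++ᵛ bobX

  ∣X∣≡3+t : ∣ X ∣ ≡ 3 + t
  ∣X∣≡3+t = begin
    ∣ X ∣                                              ≡⟨ ∣++∣ aliceX bobX ⟩
    ∣ aliceX ∣ + ∣ bobX ∣                              ≡⟨ cong₂ _+_ (∣++∣ (∅ {N}) hubsX) (∣++∣ (∅ {N}) (true ∷ [])) ⟩
    (∣ ∅ {N} ∣ + (2 + ∣ full {t} ∣)) + (∣ ∅ {N} ∣ + 1) ≡⟨ cong₂ (λ e f → e + (2 + f) + (e + 1)) (∣⊥∣≡0 N) (∣⊤∣≡n t) ⟩
    2 + (t + 1)                                        ≡⟨ cong (2 +_) (+-comm t 1) ⟩
    3 + t                                              ∎
    where open ≡-Reasoning

  ∣X∣≤4 : t ≤ 1 → ∣ X ∣ ≤ 4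
  ∣X∣≤4 t≤1 = ≤-trans (≤-reflexive ∣X∣≡3+t) (s≤s (s≤s (s≤s t≤1)))

  isOuter : Vertex N t → Bool
  isOuter (inj₁ (a _))   = false
  isOuter (inj₁ c)       = true
  isOuter (inj₁ h)       = true
  isOuter (inj₁ r)       = false
  isOuter (inj₁ (pad _)) = true
  isOuter (inj₂ (b _))   = false
  isOuter (inj₂ z)       = true

  lookup-X : ∀ w → lookup X (encode w) ≡ isOuter w
  lookup-X (inj₁ w) = trans (lookup-++ˡ aliceX bobX (join N (3 + t) w)) (alice w)
    where
    alice : ∀ w → lookup aliceX (join N (3 + t) w) ≡ isOuter (inj₁ w)
    alice (a i)   = trans (lookup-++ˡ (∅ {N}) hubsX i) (lookup-replicate i false)
    alice c       = lookup-++ʳ (∅ {N}) hubsX zero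
    alice h       = lookup-++ʳ (∅ {N}) hubsX (suc zero)
    alice r       = lookup-++ʳ (∅ {N}) hubsX (suc (suc zero))
    alice (pad k) = trans (lookup-++ʳ (∅ {N}) hubsX (suc (suc (suc k)))) (lookup-replicate k true)
  lookup-X (inj₂ w) = trans (lookup-++ʳ aliceX bobX (join N 1 w)) (bob w)
    where
    bob : ∀ w → lookup bobX (join N 1 w) ≡ isOuter (inj₂ w)
    bob (b i) = trans (lookup-++ˡ (∅ {N}) (true ∷ []) i) (lookup-replicate i false)
    bob z     = lookup-++ʳ (∅ {N}) (true ∷ []) zero

  embed : Core N → Vertex N t
  embed (aᶜ i) = inj₁ (a i)
  embed (bᶜ i) = inj₂ (b i)
  embed rᶜ     = inj₁ r

  core-view : ∀ w → isOuter w ≡ false → ∃ λ (u : Core N) → w ≡ embed u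
  core-view (inj₁ (a i)) _ = aᶜ i , refl
  core-view (inj₁ r)     _ = rᶜ , refl
  core-view (inj₂ (b i)) _ = bᶜ i , refl
  core-view (inj₁ c)       ()
  core-view (inj₁ h)       ()
  core-view (inj₁ (pad _)) ()
  core-view (inj₂ z)       ()

  outside-X : ∀ v → v ∉ X → ∃ λ u → decode v ≡ embed u
  outside-X v v∉X = core-view (decode v) (begin
    isOuter (decode v)          ≡⟨ lookup-X (decode v) ⟨
    lookup X (encode (decode v)) ≡⟨ cong (lookup X) (encode-decode v) ⟩
    lookup X v                  ≡⟨ Bool.¬-not (v∉X ∘ lookup⇒[]= v X) ⟩
    false                       ∎)
    where open ≡-Reasoning

  core∉X : ∀ u → encode (embed u) ∉ X
  core∉X u u∈X = clash (trans (sym (lookup-X (embed u))) ([]=⇒lookup u∈X)) (isOuter-core u)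
    where
    isOuter-core : ∀ u → isOuter (embed u) ≡ false
    isOuter-core (aᶜ _) = refl
    isOuter-core (bᶜ _) = refl
    isOuter-core rᶜ     = refl

module Construction {N t : ℕ} (F : Flags) where
  open Layout N t

  isHub : AliceVertex N t → Bool
  isHub c = true
  isHub h = true
  isHub _ = false

  aNeighbour : Vec Bool N → Fin N → AliceVertex N t → Bool
  aNeighbour x i (a j)   = a-clique F ∧ not (i == j)
  aNeighbour x i c       = not (lookup x i)
  aNeighbour x i h       = true
  aNeighbour x i r       = r-a F
  aNeighbour x i (pad _) = false

  -- Splitting only on the sum tags (not on c, h, r) keeps the clauses definitional for aliceAdj-sym.
  aliceAdj : Vec Bool N → AliceVertex N t → AliceVertex N t → Bool
  aliceAdj x (a i)    v        = aNeighbour x i v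
  aliceAdj x (inj₂ k) (a j)    = aNeighbour x j (inj₂ k)
  aliceAdj x (inj₂ k) (inj₂ l) = not (k == l) ∧ (isHub (inj₂ k) ∨ isHub (inj₂ l))

  bobAdj : Vec Bool N → BobVertex N → BobVertex N → Bool
  bobAdj y (b i) (b j) = b-clique F ∧ not (i == j)
  bobAdj y (b i) z     = not (lookup y i)
  bobAdj y z (b j)     = not (lookup y j)
  bobAdj y z z         = false

  cross : AliceVertex N t → BobVertex N → Bool
  cross (a i) (b j)   = i == j
  cross (a i) z       = false
  cross c _           = true
  cross h (b _)       = true
  cross h z           = false
  cross r (b _)       = r-b F
  cross r z           = false
  cross (pad _) _     = false

  -- The row of an Alice vertex mentions only x and that of a Bob vertex only y, definitionally: this is
  -- what splits the stream into a part depending on x followed by a part depending on y.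
  aliceRow : Vec Bool N → AliceVertex N t → Vertex N t → Bool
  aliceRow x u (inj₁ v) = aliceAdj x u v
  aliceRow x u (inj₂ v) = cross u v

  bobRow : Vec Bool N → BobVertex N → Vertex N t → Bool
  bobRow y u (inj₁ v) = cross v u
  bobRow y u (inj₂ v) = bobAdj y u v

  vAdj : Vec Bool N → Vec Bool N → Vertex N t → Vertex N t → Bool
  vAdj x y (inj₁ u) = aliceRow x u
  vAdj x y (inj₂ u) = bobRow y u

  aliceAdj-sym : ∀ x u v → aliceAdj x u v ≡ aliceAdj x v u
  aliceAdj-sym x (a i)    (a j)    = cong (λ e → a-clique F ∧ not e) (==-sym i j)
  aliceAdj-sym x (a i)    (inj₂ k) = refl
  aliceAdj-sym x (inj₂ k) (a j)    = refl
  aliceAdj-sym x (inj₂ k) (inj₂ l) =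
    cong₂ (λ e f → not e ∧ f) (==-sym k l) (Bool.∨-comm (isHub (inj₂ k)) (isHub (inj₂ l)))

  bobAdj-sym : ∀ y u v → bobAdj y u v ≡ bobAdj y v u
  bobAdj-sym y (b i) (b j) = cong (λ e → b-clique F ∧ not e) (==-sym i j)
  bobAdj-sym y (b i) z     = refl
  bobAdj-sym y z (b j)     = refl
  bobAdj-sym y z z         = refl

  vAdj-sym : ∀ x y u v → vAdj x y u v ≡ vAdj x y v u
  vAdj-sym x y (inj₁ u) (inj₁ v) = aliceAdj-sym x u v
  vAdj-sym x y (inj₁ u) (inj₂ v) = refl
  vAdj-sym x y (inj₂ u) (inj₁ v) = refl
  vAdj-sym x y (inj₂ u) (inj₂ v) = bobAdj-sym y u v

  vAdj-irrefl : ∀ x y v → vAdj x y v v ≡ false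
  vAdj-irrefl x y (inj₁ (a i)) rewrite ==-refl i = Bool.∧-zeroʳ (a-clique F)
  vAdj-irrefl x y (inj₁ (inj₂ k)) rewrite ==-refl k = refl
  vAdj-irrefl x y (inj₂ (b i)) rewrite ==-refl i = Bool.∧-zeroʳ (b-clique F)
  vAdj-irrefl x y (inj₂ z) = refl

  graph : Vec Bool N → Vec Bool N → Graph n
  graph x y = record
    { adj    = λ u v → vAdj x y (decode u) (decode v)
    ; sym    = λ u v → vAdj-sym x y (decode u) (decode v)
    ; irrefl = λ v → vAdj-irrefl x y (decode v)
    }

  module _ (x y : Vec Bool N) where

    adj-encode : ∀ u v → adj (graph x y) (encode u) (encode v) ≡ vAdj x y u v
    adj-encode u v = cong₂ (vAdj x y) (decode-encode u) (decode-encode v)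

    within2-graph : ∀ {u v} → Within2 (vAdj x y) (decode u) (decode v) → Within2 (adj (graph x y)) u v
    within2-graph (inj₁ e)                    = inj₁ (decode-injective e)
    within2-graph (inj₂ (inj₁ uv))            = inj₂ (inj₁ uv)
    within2-graph {u} {v} (inj₂ (inj₂ (m , um , mv))) =
      inj₂ (inj₂ (encode m , trans (cong (vAdj x y (decode u)) (decode-encode m)) um
                           , trans (cong (λ w → vAdj x y w (decode v)) (decode-encode m)) mv))

    graph-within2 : ∀ {u v} → Within2 (adj (graph x y)) u v → Within2 (vAdj x y) (decode u) (decode v)
    graph-within2 (inj₁ e)                    = inj₁ (cong decode e)
    graph-within2 (inj₂ (inj₁ uv))            = inj₂ (inj₁ uv)
    graph-within2 (inj₂ (inj₂ (m , um , mv))) = inj₂ (inj₂ (decode m , um , mv))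

    near-h : ∀ v → v ≡ inj₂ z ⊎ v ≡ inj₁ h ⊎ vAdj x y v (inj₁ h) ≡ true
    near-h (inj₁ (a i))   = inj₂ (inj₂ refl)
    near-h (inj₁ c)       = inj₂ (inj₂ refl)
    near-h (inj₁ h)       = inj₂ (inj₁ refl)
    near-h (inj₁ r)       = inj₂ (inj₂ refl)
    near-h (inj₁ (pad _)) = inj₂ (inj₂ refl)
    near-h (inj₂ (b _))   = inj₂ (inj₂ refl)
    near-h (inj₂ z)       = inj₁ refl

    -- z reaches aᵢ in two steps only through c (when xᵢ = 0) or through bᵢ (when yᵢ = 0).
    module _ (disjoint : ∀ i → lookup x i ≡ false ⊎ lookup y i ≡ false) where

      z-within2 : ∀ v → Within2 (vAdj x y) (inj₂ z) v
      z-within2 (inj₁ (a i)) with disjoint i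
      ... | inj₁ xᵢ = inj₂ (inj₂ (inj₁ c , refl , cong not xᵢ))
      ... | inj₂ yᵢ = inj₂ (inj₂ (inj₂ (b i) , cong not yᵢ , ==-refl i))
      z-within2 (inj₁ c)       = inj₂ (inj₁ refl)
      z-within2 (inj₁ h)       = inj₂ (inj₂ (inj₁ c , refl , refl))
      z-within2 (inj₁ r)       = inj₂ (inj₂ (inj₁ c , refl , refl))
      z-within2 (inj₁ (pad _)) = inj₂ (inj₂ (inj₁ c , refl , refl))
      z-within2 (inj₂ (b _))   = inj₂ (inj₂ (inj₁ c , refl , refl))
      z-within2 (inj₂ z)       = inj₁ refl

      all-within2 : ∀ s t → Within2 (vAdj x y) s t
      all-within2 s t with near-h s | near-h t
      ... | inj₁ refl | _         = z-within2 t
      ... | inj₂ _    | inj₁ refl = within2-sym (vAdj-sym x y) (z-within2 s)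
      ... | inj₂ s∼h  | inj₂ t∼h  = within2-via (vAdj-sym x y) (inj₁ h) s∼h t∼h

    a-z-far : ∀ {i} → lookup x i ≡ true → lookup y i ≡ true → ¬ Within2 (vAdj x y) (inj₁ (a i)) (inj₂ z)
    a-z-far xᵢ yᵢ (inj₁ ())
    a-z-far xᵢ yᵢ (inj₂ (inj₁ ()))
    a-z-far xᵢ yᵢ (inj₂ (inj₂ (inj₁ (a _) , _ , ())))
    a-z-far xᵢ yᵢ (inj₂ (inj₂ (inj₁ c , ac , _))) = clash ac (cong not xᵢ)
    a-z-far xᵢ yᵢ (inj₂ (inj₂ (inj₁ h , _ , ())))
    a-z-far xᵢ yᵢ (inj₂ (inj₂ (inj₁ r , _ , ())))
    a-z-far xᵢ yᵢ (inj₂ (inj₂ (inj₁ (pad _) , _ , ())))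
    a-z-far {i} xᵢ yᵢ (inj₂ (inj₂ (inj₂ (b j) , ab , bz))) with ==⇒≡ i j ab
    ... | refl = clash bz (cong not yᵢ)
    a-z-far xᵢ yᵢ (inj₂ (inj₂ (inj₂ z , () , _)))

  diameter-disjoint : ∀ {x y} → (∀ i → lookup x i ≡ false ⊎ lookup y i ≡ false) →
    ∀ {d} → DiameterIs (graph x y) d → ∃ λ D → d ≡ just D × D ≤ 2
  diameter-disjoint {x} {y} disjoint =
    diameter≤2 (graph x y) λ u v → within2-graph x y (all-within2 x y disjoint (decode u) (decode v))

  diameter-intersecting : ∀ {x y i} → lookup x i ≡ true → lookup y i ≡ true →
    ∀ {D} → D ≤ 2 → ¬ DiameterIs (graph x y) (just D)
  diameter-intersecting {x} {y} {i} xᵢ yᵢ = diameter≰2 (graph x y) λ close →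
    a-z-far x y xᵢ yᵢ (subst₂ (Within2 (vAdj x y)) (decode-encode (inj₁ (a i))) (decode-encode (inj₂ z))
                                (graph-within2 x y close))

  aliceItem : Vec Bool N → Fin nA → ALItem n
  aliceItem x w = item (w ↑ˡ nB) (neighbours (aliceRow x (splitAt N w) ∘ decode))

  bobItem : Vec Bool N → Fin nB → ALItem n
  bobItem y w = item (nA ↑ʳ w) (neighbours (bobRow y (splitAt N w) ∘ decode))

  stream : Vec Bool N → Vec Bool N → List (ALItem n)
  stream x y = tabulate (aliceItem x) ++ tabulate (bobItem y)

  tokens-stream : ∀ x y → tokens (stream x y) ≡ tokens (tabulate (aliceItem x)) ++ tokens (tabulate (bobItem y))
  tokens-stream x y = concatMap-++ _ (tabulate (aliceItem x)) (tabulate (bobItem y))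

  stream-valid : ∀ x y → ValidStream (graph x y) (stream x y)
  stream-valid x y = ↭-reflexive vertices-in-order , rows
    where
    vertices-in-order : map vertex (stream x y) ≡ allFin n
    vertices-in-order = begin
      map vertex (tabulate (aliceItem x) ++ tabulate (bobItem y))
        ≡⟨ map-++ vertex (tabulate (aliceItem x)) (tabulate (bobItem y)) ⟩
      map vertex (tabulate (aliceItem x)) ++ map vertex (tabulate (bobItem y))
        ≡⟨ cong₂ _++_ (map-tabulate (aliceItem x) vertex) (map-tabulate (bobItem y) vertex) ⟩
      tabulate {n = nA} (_↑ˡ nB) ++ tabulate (nA ↑ʳ_)
        ≡⟨ tabulate-+ nA {nB} id ⟨
      allFin n ∎
      where open ≡-Reasoning
    rows : ∀ {it} → it ∈ₗ stream x y →
      Unique (nbrs it) × (∀ u → u ∈ₗ nbrs it ⇔ adj (graph x y) (vertex it) u ≡ true)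
    rows it∈ with ∈-++⁻ (tabulate (aliceItem x)) it∈
    ... | inj₁ ∈alice with w , refl ← ∈-tabulate⁻ ∈alice =
      neighbours-valid (graph x y) (w ↑ˡ nB) _ λ u →
        cong (λ s → vAdj x y s (decode u)) (sym (cong (Sum.map (splitAt N) (splitAt N)) (splitAt-↑ˡ nA w nB)))
    ... | inj₂ ∈bob with w , refl ← ∈-tabulate⁻ ∈bob =
      neighbours-valid (graph x y) (nA ↑ʳ w) _ λ u →
        cong (λ s → vAdj x y s (decode u)) (sym (cong (Sum.map (splitAt N) (splitAt N)) (splitAt-↑ʳ nA nB w)))

  -- G(x, y) − X; its adjacency does not actually depend on x and y.
  coreAdj : Vec Bool N → Vec Bool N → Core N → Core N → Bool
  coreAdj x y u v = vAdj x y (embed u) (embed v)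

  coreAdj-sym : ∀ x y u v → coreAdj x y u v ≡ coreAdj x y v u
  coreAdj-sym x y u v = vAdj-sym x y (embed u) (embed v)

  core-embedding : ∀ {m} {H : Graph m} x y →
    (Σ (Fin m → Fin n) λ f → (∀ i j → f i ≡ f j → i ≡ j) × (∀ i → f i ∉ X) ×
                              (∀ i j → adj (graph x y) (f i) (f j) ≡ adj H i j)) →
    Embedding (adj H) (coreAdj x y)
  core-embedding {H = H} x y (f , f-injective , avoids-X , f-adj) = record
    { apply         = λ i → proj₁ (outside-X (f i) (avoids-X i))
    ; injective     = λ {i} {j} e →
        f-injective i j (decode-injective (trans (at i) (trans (cong embed e) (sym (at j)))))
    ; preserves-adj = λ i j → trans (sym (cong₂ (vAdj x y) (at i) (at j))) (f-adj i j)
    }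
    where
    at : ∀ i → decode (f i) ≡ embed (proj₁ (outside-X (f i) (avoids-X i)))
    at i = proj₂ (outside-X (f i) (avoids-X i))

  minus-free : ∀ {P : ∀ {V : Set} → Adjacency V → Set} → Hereditary P → ∀ {m} {H : Graph m} → P (adj H) →
    (∀ x y → ¬ P (coreAdj x y)) → ∀ x y → HFreeMinus H (graph x y) X
  minus-free hereditary {H = H} P-H core-free x y embedding =
    core-free x y (hereditary (core-embedding {H = H} x y embedding) P-H)

  module _ (r∼a : r-a F ≡ true) (x y : Vec Bool N) where

    private
      in-core : ∀ u → encode (embed u) ∈ ∁ X
      in-core u = x∉p⇒x∈∁p (core∉X u)

      core-edge : ∀ u v → coreAdj x y u v ≡ true → adj (graph x y) (encode (embed u)) (encode (embed v)) ≡ true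
      core-edge u v e = trans (adj-encode x y (embed u) (embed v)) e

    to-r : ∀ u → ∃ λ k → WalkIn (graph x y) (∁ X) (encode (embed u)) (encode (embed rᶜ)) k
    to-r (aᶜ i) = 1 , step (in-core (aᶜ i)) (core-edge (aᶜ i) rᶜ r∼a) (here (in-core rᶜ))
    to-r (bᶜ i) = 2 , step (in-core (bᶜ i)) (core-edge (bᶜ i) (aᶜ i) (==-refl i))
                        (step (in-core (aᶜ i)) (core-edge (aᶜ i) rᶜ r∼a) (here (in-core rᶜ)))
    to-r rᶜ     = 0 , here (in-core rᶜ)

    connected : ConnectedMinus (graph x y) X
    connected s t s∉X t∉X
      with u , su ← outside-X s s∉X | v , tv ← outside-X t t∉X
      with k , s→r ← to-r u | l , t→r ← to-r v
      = k + l , subst₂ (λ s t → WalkIn (graph x y) (∁ X) s t (k + l)) (at s su) (at t tv)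
                       (walk-++ s→r (walk-reverse t→r))
      where
      at : ∀ v {u} → decode v ≡ embed u → encode (embed u) ≡ v
      at v e = trans (cong encode (sym e)) (encode-decode v)

-- The lower bound for a family of constructions

complement : ∀ {N} → Vec Bool N → Vec Bool N
complement = mapᵛ not

disjoint-complement : ∀ {N} (x : Vec Bool N) i → lookup x i ≡ false ⊎ lookup (complement x) i ≡ false
disjoint-complement x i with lookup x i in xᵢ
... | false = inj₁ refl
... | true  = inj₂ (trans (lookup-map i not x) (cong not xᵢ))

module _ {N t : ℕ} (F : Flags) where
  open Layout N t
  open Construction {N} {t} F

  stream-bound : (C : InputClass n) → (∀ x y → C (graph x y) X) →
    ∀ {p bits} (A : Subset n → Algorithm n p bits) → SolvesDiameter C A → N ≤ p * (bits + bits)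
  stream-bound C members {p} {bits} A solves = ≮⇒≥ fooled
    where
    open Passes (A X)
    aliceTokens bobTokens : Vec Bool N → List (Token n)
    aliceTokens x = tokens (tabulate (aliceItem x))
    bobTokens   y = tokens (tabulate (bobItem y))

    answer : ∀ x y → DiameterIs (graph x y) (out (A X) (run (aliceTokens x ++ bobTokens y)))
    answer x y = subst (λ ts → DiameterIs (graph x y) (out (A X) (run ts))) (tokens-stream x y)
                       (solves (graph x y) X (members x y) (stream x y) (stream-valid x y))

    fooled : p * (bits + bits) < N → ⊥
    fooled short
      with x , x′ , i , xᵢ , x′ᵢ , same ← fooling-pair aliceTokens (bobTokens ∘ complement) short
      with D , answer≡ , D≤2 ← diameter-disjoint (disjoint-complement x) (answer x (complement x))
      = diameter-intersecting xᵢ (trans (lookup-map i not x′) (cong not x′ᵢ)) D≤2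
          (subst (DiameterIs (graph x (complement x′))) (trans (cong (out (A X)) same) answer≡)
                 (answer x (complement x′)))

-- The padding vertex (t = 1) adjusts the parity of n = 2N + 4 + t.
every-size : ∀ k → ∃₂ λ N t → 1 ≤ N × t ≤ 1 × Layout.n N t ≡ 6 + k
every-size zero          = 1 , 0 , s≤s z≤n , z≤n , refl
every-size (suc zero)    = 1 , 1 , s≤s z≤n , s≤s z≤n , refl
every-size (suc (suc k)) with N , t , 1≤N , t≤1 , size≡ ← every-size k =
  suc N , t , s≤s z≤n , t≤1 , cong suc (trans (+-suc (N + (3 + t)) (N + 1)) (cong suc size≡))

size≤7N : ∀ {N t} → 1 ≤ N → t ≤ 1 → Layout.n N t ≤ 7 * N
size≤7N {N} {t} 1≤N t≤1 = begin
  (N + (3 + t)) + (N + 1) ≤⟨ +-monoˡ-≤ (N + 1) (+-monoʳ-≤ N (s≤s (s≤s (s≤s t≤1)))) ⟩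
  (N + 4) + (N + 1)       ≡⟨ arrange N ⟩
  2 * N + 5               ≤⟨ +-monoʳ-≤ (2 * N) (*-monoʳ-≤ 5 1≤N) ⟩
  2 * N + 5 * N           ≡⟨ collect N ⟩
  7 * N                   ∎
  where
  open ≤-Reasoning
  arrange : ∀ N → (N + 4) + (N + 1) ≡ 2 * N + 5
  arrange = solve-∀
  collect : ∀ N → 2 * N + 5 * N ≡ 7 * N
  collect = solve-∀

lower-bound : (F : Flags) (C : ∀ n → InputClass n) →
  (∀ N t → t ≤ 1 → ∀ x y → C (Layout.n N t) (Construction.graph {N} {t} F x y) (Layout.X N t)) →
  LowerBoundΩnp C
lower-bound F C members = 14 , 6 , bound
  where
  bound-at : ∀ N t → 1 ≤ N → t ≤ 1 → ∀ {p bits} (A : Subset (Layout.n N t) → Algorithm _ p bits) →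
    SolvesDiameter (C _) A → Layout.n N t ≤ 14 * (bits * p)
  bound-at N t 1≤N t≤1 {p} {bits} A solves = begin
    Layout.n N t          ≤⟨ size≤7N 1≤N t≤1 ⟩
    7 * N                 ≤⟨ *-monoʳ-≤ 7 (stream-bound F (C _) (members N t t≤1) A solves) ⟩
    7 * (p * (bits + bits)) ≡⟨ rearrange p bits ⟩
    14 * (bits * p)       ∎
    where
    open ≤-Reasoning
    rearrange : ∀ p bits → 7 * (p * (bits + bits)) ≡ 14 * (bits * p)
    rearrange = solve-∀

  bound : ∀ n → 6 ≤ n → ∀ p → 1 ≤ p → ∀ bits (A : Subset n → Algorithm n p bits) →
    SolvesDiameter (C n) A → n ≤ 14 * (bits * p)
  bound n 6≤n p _ bits A solves
    with N , t , 1≤N , t≤1 , size≡ ← every-size (n ∸ 6)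
    with refl ← trans size≡ (m+[n∸m]≡n 6≤n)
    = bound-at N t 1≤N t≤1 A solves

matching spider split co-bipartite apex-matching : Flags
matching      = flags false false false false
spider        = flags false false true  false
split         = flags true  false true  false
co-bipartite  = flags true  true  true  false
apex-matching = flags false false true  true

module _ {N t : ℕ} (x y : Vec Bool N) where

  private
    module M = Construction {N} {t} matching
    module S = Construction {N} {t} spider
    module P = Construction {N} {t} split
    module C = Construction {N} {t} co-bipartite
    module W = Construction {N} {t} apex-matching

  matching-P₃-free : ¬ HasP₃ (M.coreAdj x y)
  matching-P₃-free =
    P₃-free-if-unique-neighbours {E = M.coreAdj x y} (M.coreAdj-sym x y) (λ {u} → unique {u})
    where
    unique : ∀ {u v w} → M.coreAdj x y u v ≡ true → M.coreAdj x y u w ≡ true → v ≡ w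
    unique {aᶜ i} {bᶜ j} {bᶜ k} e f = cong bᶜ (trans (sym (==⇒≡ i j e)) (==⇒≡ i k f))
    unique {bᶜ i} {aᶜ j} {aᶜ k} e f = cong aᶜ (trans (==⇒≡ j i e) (sym (==⇒≡ k i f)))
    unique {aᶜ _} {aᶜ _} ()
    unique {aᶜ _} {rᶜ}   ()
    unique {aᶜ _} {bᶜ _} {aᶜ _} _ ()
    unique {aᶜ _} {bᶜ _} {rᶜ}   _ ()
    unique {bᶜ _} {bᶜ _} ()
    unique {bᶜ _} {rᶜ}   ()
    unique {bᶜ _} {aᶜ _} {bᶜ _} _ ()
    unique {bᶜ _} {aᶜ _} {rᶜ}   _ ()
    unique {rᶜ}   {aᶜ _} ()
    unique {rᶜ}   {bᶜ _} ()
    unique {rᶜ}   {rᶜ}   ()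

  spider-K₃-free : ¬ HasK₃ (S.coreAdj x y)
  spider-K₃-free = K₃-free-if-bipartite {E = S.coreAdj x y} (S.coreAdj-sym x y) is-a (λ {u} → proper {u})
    where
    is-a : Core N → Bool
    is-a (aᶜ _) = true
    is-a _      = false
    proper : ∀ {u v} → S.coreAdj x y u v ≡ true → is-a u ≢ is-a v
    proper {aᶜ _} {bᶜ _} _ ()
    proper {aᶜ _} {rᶜ}   _ ()
    proper {bᶜ _} {aᶜ _} _ ()
    proper {rᶜ}   {aᶜ _} _ ()
    proper {aᶜ _} {aᶜ _} ()
    proper {bᶜ _} {bᶜ _} ()
    proper {bᶜ _} {rᶜ}   ()
    proper {rᶜ}   {bᶜ _} ()
    proper {rᶜ}   {rᶜ}   ()

  private
    not-b : Core N → Bool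
    not-b (bᶜ _) = false
    not-b _      = true

    split-clique : ∀ {u v} → not-b u ≡ true → not-b v ≡ true → u ≢ v → P.coreAdj x y u v ≡ true
    split-clique {aᶜ i} {aᶜ j} _ _ u≢v = cong not (==-false (u≢v ∘ cong aᶜ))
    split-clique {aᶜ _} {rᶜ}   _ _ _   = refl
    split-clique {rᶜ}   {aᶜ _} _ _ _   = refl
    split-clique {rᶜ}   {rᶜ}   _ _ u≢v = ⊥-elim (u≢v refl)

    split-cover : ∀ {u v} → P.coreAdj x y u v ≡ true → not-b u ≡ true ⊎ not-b v ≡ true
    split-cover {aᶜ _}        _ = inj₁ refl
    split-cover {rᶜ}          _ = inj₁ refl
    split-cover {bᶜ _} {aᶜ _} _ = inj₂ refl
    split-cover {bᶜ _} {rᶜ}   _ = inj₂ refl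
    split-cover {bᶜ _} {bᶜ _} ()

  split-2K₂-free : ¬ Has2K₂ (P.coreAdj x y)
  split-2K₂-free = 2K₂-free-if-split {E = P.coreAdj x y} (P.coreAdj-sym x y) not-b
    (λ {u} → split-clique {u}) (λ {u} → split-cover {u})

  split-C₄-free : ¬ HasC₄ (P.coreAdj x y)
  split-C₄-free = C₄-free-if-split {E = P.coreAdj x y} (P.coreAdj-sym x y) not-b
    (λ {u} → split-clique {u}) (λ {u} → split-cover {u})

  co-bipartite-3P₁-free : ¬ Has3P₁ (C.coreAdj x y)
  co-bipartite-3P₁-free =
    3P₁-free-if-two-cliques {E = C.coreAdj x y} (C.coreAdj-sym x y) is-b (λ {u} → clique {u})
    where
    is-b : Core N → Bool
    is-b (bᶜ _) = true
    is-b _      = false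
    clique : ∀ {u v} → is-b u ≡ is-b v → u ≢ v → C.coreAdj x y u v ≡ true
    clique {aᶜ i} {aᶜ j} _ u≢v = cong not (==-false (u≢v ∘ cong aᶜ))
    clique {bᶜ i} {bᶜ j} _ u≢v = cong not (==-false (u≢v ∘ cong bᶜ))
    clique {aᶜ _} {rᶜ}   _ _   = refl
    clique {rᶜ}   {aᶜ _} _ _   = refl
    clique {rᶜ}   {rᶜ}   _ u≢v = ⊥-elim (u≢v refl)
    clique {aᶜ _} {bᶜ _} ()
    clique {bᶜ _} {aᶜ _} ()
    clique {bᶜ _} {rᶜ}   ()
    clique {rᶜ}   {bᶜ _} ()

  apex-matching-P₄-free : ¬ HasP₄ (W.coreAdj x y)
  apex-matching-P₄-free = P₄-free-if-apex-over-matching {E = W.coreAdj x y} (W.coreAdj-sym x y) rᶜ apex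
    (λ {u} → matched {u})
    where
    apex : ∀ v → v ≡ rᶜ ⊎ W.coreAdj x y rᶜ v ≡ true
    apex (aᶜ _) = inj₂ refl
    apex (bᶜ _) = inj₂ refl
    apex rᶜ     = inj₁ refl
    matched : ∀ {u v w} → W.coreAdj x y rᶜ u ≡ true → W.coreAdj x y u v ≡ true → W.coreAdj x y u w ≡ true →
              v ≡ rᶜ ⊎ w ≡ rᶜ ⊎ v ≡ w
    matched {_}    {rᶜ}   _ _ _ = inj₁ refl
    matched {_}    {_}    {rᶜ} _ _ _ = inj₂ (inj₁ refl)
    matched {aᶜ i} {bᶜ j} {bᶜ k} _ e f = inj₂ (inj₂ (cong bᶜ (trans (sym (==⇒≡ i j e)) (==⇒≡ i k f))))
    matched {bᶜ i} {aᶜ j} {aᶜ k} _ e f = inj₂ (inj₂ (cong aᶜ (trans (==⇒≡ j i e) (sym (==⇒≡ k i f)))))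
    matched {aᶜ _} {aᶜ _} _ ()
    matched {aᶜ _} {bᶜ _} {aᶜ _} _ _ ()
    matched {bᶜ _} {bᶜ _} _ ()
    matched {bᶜ _} {aᶜ _} {bᶜ _} _ _ ()
    matched {rᶜ} ()

module _ {m : ℕ} (H : Graph m) (F : Flags) (P : ∀ {V : Set} → Adjacency V → Set) (hereditary : Hereditary P)
         (P-H : P (adj H)) (core-free : ∀ {N t} x y → ¬ P (Construction.coreAdj {N} {t} F x y)) where

  Class₁-lower-bound : LowerBoundΩnp (Class₁ H 4)
  Class₁-lower-bound = lower-bound F (Class₁ H 4) λ N t t≤1 x y →
    Layout.∣X∣≤4 N t t≤1 , Construction.minus-free {N} {t} F {P} hereditary {H = H} P-H core-free x y

  Class₂-lower-bound : r-a F ≡ true → LowerBoundΩnp (Class₂ H 4)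
  Class₂-lower-bound r∼a = lower-bound F (Class₂ H 4) λ N t t≤1 x y →
    Layout.∣X∣≤4 N t t≤1 , Construction.minus-free {N} {t} F {P} hereditary {H = H} P-H core-free x y ,
    Construction.connected {N} {t} F r∼a x y

theorem3 : ∀ {m} (H : Graph m) → 1 ≤ m →
    (∀ s → s ≤ 2 → ¬ Iso H (P₂+ s P₁)) →
    (∀ s → 1 ≤ s → s ≤ 3 → ¬ Iso H (edgeless s)) →
    (∃[ k ] LowerBoundΩnp (Class₁ H k)) ×
    (¬ Iso H P₃ → ∃[ k ] LowerBoundΩnp (Class₂ H k))
theorem3 H 1≤m not-P₂+sP₁ not-sP₁ =
  (4 , class₁ (contains-P₃-K₃-2K₂-or-3P₁ H 1≤m not-P₂+sP₁ not-sP₁)) ,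
  λ not-P₃ → 4 , class₂ (contains-K₃-2K₂-3P₁-P₄-or-C₄ H 1≤m not-P₂+sP₁ not-sP₁ not-P₃)
  where
  class₁ : HasP₃ (adj H) ⊎ HasK₃ (adj H) ⊎ Has2K₂ (adj H) ⊎ Has3P₁ (adj H) → LowerBoundΩnp (Class₁ H 4)
  class₁ (inj₁ p₃)               = Class₁-lower-bound H matching     HasP₃  P₃-hereditary  p₃ matching-P₃-free
  class₁ (inj₂ (inj₁ k₃))        = Class₁-lower-bound H spider       HasK₃  K₃-hereditary  k₃ spider-K₃-free
  class₁ (inj₂ (inj₂ (inj₁ t)))  = Class₁-lower-bound H split        Has2K₂ 2K₂-hereditary t  split-2K₂-free
  class₁ (inj₂ (inj₂ (inj₂ i₃))) = Class₁-lower-bound H co-bipartite Has3P₁ 3P₁-hereditary i₃ co-bipartite-3P₁-free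

  class₂ : HasK₃ (adj H) ⊎ Has2K₂ (adj H) ⊎ Has3P₁ (adj H) ⊎ HasP₄ (adj H) ⊎ HasC₄ (adj H) →
    LowerBoundΩnp (Class₂ H 4)
  class₂ (inj₁ k₃)                      = Class₂-lower-bound H spider        HasK₃  K₃-hereditary  k₃ spider-K₃-free        refl
  class₂ (inj₂ (inj₁ t))                = Class₂-lower-bound H split         Has2K₂ 2K₂-hereditary t  split-2K₂-free        refl
  class₂ (inj₂ (inj₂ (inj₁ i₃)))        = Class₂-lower-bound H co-bipartite  Has3P₁ 3P₁-hereditary i₃ co-bipartite-3P₁-free refl
  class₂ (inj₂ (inj₂ (inj₂ (inj₁ p₄)))) = Class₂-lower-bound H apex-matching HasP₄  P₄-hereditary  p₄ apex-matching-P₄-free refl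
  class₂ (inj₂ (inj₂ (inj₂ (inj₂ c₄)))) = Class₂-lower-bound H split         HasC₄  C₄-hereditary  c₄ split-C₄-free         refl
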